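{- Let $m$ be a nonnegative integer. Then $$\sum_{s=0}^{m}\binom{2s}{s}\binom{s}{m-s}\frac{(-1)^s}{s+1}H^{(2)}_s=\frac{2(-1)^m}{m+1}\sum_{s=0}^{m}H^{(2)}_s,$$ where $H^{(2)}_n=\sum_{k=1}^{n}\frac{1}{k^2}$ (so $H^{(2)}_0=0$).
   Context: Binomial coefficients $\binom{s}{j}$ are zero when $j<0$ or $j>s$. -}

module Defs where

open import Data.Nat as ℕ using (ℕ; zero; suc; _∸_)
open import Data.Nat.Combinatorics using (_C_)
open import Data.Integer as ℤ using (ℤ; +_)
open import Data.Rational as ℚ using (ℚ; _/_; 0ℚ; _+_; _*_; -_)

sumTo : ℕ → (ℕ → ℚ) → ℚ
sumTo zero    f = f 0
sumTo (suc n) f = sumTo n f + f (suc n)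

sign : ℕ → ℚ
sign zero    = ℚ.1ℚ
sign (suc n) = - sign n

ℕtoℚ : ℕ → ℚ
ℕtoℚ n = (+ n) / 1

H2 : ℕ → ℚ
H2 zero    = 0ℚ
H2 (suc n) = H2 n + (+ 1) / (suc n ℕ.* suc n)

-- Let F m be the left-hand side and G m = (m + 1) F m. Both G and G′ m = 2 (-1)^m Σ_{s ≤ m} H2 s
-- satisfy  G M + 2 G (M - 1) + G (M - 2) = 2 (-1)^M / M²  for M ≥ 2 and agree at m = 0, 1, so they
-- coincide. For G′ this is H2 M − H2 (M - 1) = 1 / M². For G it comes from creative telescoping: M times the
-- recurrence applied to the coefficient (-1)^s C(2s,s) C(s,m-s) / (s+1) of H2 s is a difference
-- Q s − Q (s + 1) of hypergeometric terms. Summing against H2 s by parts turns M·(G M + 2 G (M-1) + G (M-2))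
-- into T M = Σ_s Q (s + 1) / (s + 1)², and a second certificate gives M·T M + (M-1)·T (M-1) = 0, whence
-- M·T M = 2 (-1)^M.
module Submission where

open import Defs

open import Data.Nat as ℕ using (ℕ; zero; suc; _∸_; _<_; _≤_; z≤n; s≤s)
import Data.Nat.Properties as ℕP
open import Data.Nat.Combinatorics using (_C_; nCk+nC[k+1]≡[n+1]C[k+1]; nC1≡n; nCk≡nC[n∸k])
open import Data.List using (_∷_; [])
open import Data.Product using (_×_; _,_; proj₁)
open import Data.Sum using (inj₁; inj₂)
open import Relation.Binary.Definitions using (tri<; tri≈; tri>)
open import Relation.Binary.PropositionalEquality
open ≡-Reasoning

module Binomial where
  open import Data.Nat using (_+_; _*_)
  open import Data.Nat.Tactic.RingSolver using (solve-∀)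

  [1+k]*[1+n]C[1+k]≡[1+n]*nCk : ∀ n k → suc k * (suc n C suc k) ≡ suc n * (n C k)
  [1+k]*[1+n]C[1+k]≡[1+n]*nCk zero    zero    = refl
  [1+k]*[1+n]C[1+k]≡[1+n]*nCk zero    (suc k) = ℕP.*-zeroʳ (suc (suc k))
  [1+k]*[1+n]C[1+k]≡[1+n]*nCk (suc n) zero    =
    trans (ℕP.*-identityˡ _) (trans (nC1≡n (suc (suc n))) (sym (ℕP.*-identityʳ (suc (suc n)))))
  [1+k]*[1+n]C[1+k]≡[1+n]*nCk (suc n) (suc k) = begin
    suc (suc k) * (suc (suc n) C suc (suc k))
      ≡⟨ cong (suc (suc k) *_) (sym (nCk+nC[k+1]≡[n+1]C[k+1] (suc n) (suc k))) ⟩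
    suc (suc k) * (X + Y)
      ≡⟨ expand k X Y ⟩
    X + (suc k * X + suc (suc k) * Y)
      ≡⟨ cong₂ (λ p q → X + (p + q)) ([1+k]*[1+n]C[1+k]≡[1+n]*nCk n k) ([1+k]*[1+n]C[1+k]≡[1+n]*nCk n (suc k)) ⟩
    X + (suc n * (n C k) + suc n * (n C suc k))
      ≡⟨ cong (λ p → p + (suc n * (n C k) + suc n * (n C suc k))) (sym (nCk+nC[k+1]≡[n+1]C[k+1] n k)) ⟩
    (n C k + n C suc k) + (suc n * (n C k) + suc n * (n C suc k))
      ≡⟨ collect n (n C k) (n C suc k) ⟩
    suc (suc n) * (n C k + n C suc k)
      ≡⟨ cong (suc (suc n) *_) (nCk+nC[k+1]≡[n+1]C[k+1] n k) ⟩
    suc (suc n) * (suc n C suc k)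
      ∎
    where
    X = suc n C suc k
    Y = suc n C suc (suc k)
    expand : ∀ k X Y → suc (suc k) * (X + Y) ≡ X + (suc k * X + suc (suc k) * Y)
    expand = solve-∀
    collect : ∀ n A B → (A + B) + (suc n * A + suc n * B) ≡ suc (suc n) * (A + B)
    collect = solve-∀

  [1+n]*[2+2n]C[1+n]≡2*[1+2n]*[2n]Cn : ∀ n → suc n * ((2 * suc n) C suc n) ≡ 2 * suc (2 * n) * ((2 * n) C n)
  [1+n]*[2+2n]C[1+n]≡2*[1+2n]*[2n]Cn n = begin
    suc n * ((2 * suc n) C suc n)
      ≡⟨ cong (λ m → suc n * (m C suc n)) (double-suc n) ⟩
    suc n * (suc (suc (2 * n)) C suc n)
      ≡⟨ [1+k]*[1+n]C[1+k]≡[1+n]*nCk (suc (2 * n)) n ⟩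
    suc (suc (2 * n)) * (suc (2 * n) C n)
      ≡⟨ cong₂ _*_ (double-suc n) middle-symmetric ⟨
    (2 * suc n) * (suc (2 * n) C suc n)
      ≡⟨ ℕP.*-assoc 2 (suc n) _ ⟩
    2 * (suc n * (suc (2 * n) C suc n))
      ≡⟨ cong (2 *_) ([1+k]*[1+n]C[1+k]≡[1+n]*nCk (2 * n) n) ⟩
    2 * (suc (2 * n) * ((2 * n) C n))
      ≡⟨ ℕP.*-assoc 2 (suc (2 * n)) _ ⟨
    2 * suc (2 * n) * ((2 * n) C n)
      ∎
    where
    double-suc : ∀ n → 2 * suc n ≡ suc (suc (2 * n))
    double-suc = solve-∀
    middle-symmetric : suc (2 * n) C suc n ≡ suc (2 * n) C n
    middle-symmetric = begin
      suc (2 * n) C suc n                  ≡⟨ nCk≡nC[n∸k] (s≤s (ℕP.m≤n*m n 2)) ⟩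
      suc (2 * n) C (suc (2 * n) ∸ suc n)  ≡⟨ cong (suc (2 * n) C_) (trans (ℕP.m+n∸m≡n n (n + 0)) (ℕP.+-identityʳ n)) ⟩
      suc (2 * n) C n                      ∎

  -- B m s = C(s, m − s), defined so that it vanishes for s > m instead of truncating m − s.
  B : ℕ → ℕ → ℕ
  B zero          zero    = 1
  B zero          (suc s) = 0
  B (suc m)       zero    = 0
  B (suc zero)    (suc s) = B zero s
  B (suc (suc m)) (suc s) = B (suc m) s + B m s

  B-vanish : ∀ {m s} → m < s → B m s ≡ 0
  B-vanish {zero}        {suc s}       _               = refl
  B-vanish {suc zero}    {suc zero}    (s≤s ())
  B-vanish {suc zero}    {suc (suc s)} _               = refl
  B-vanish {suc (suc m)} {suc s}       (s≤s m+1<s) =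
    cong₂ _+_ (B-vanish m+1<s) (B-vanish (ℕP.<-trans (ℕP.n<1+n m) m+1<s))

  B-diagonal : ∀ s → B s s ≡ 1
  B-diagonal zero          = refl
  B-diagonal (suc zero)    = refl
  B-diagonal (suc (suc s)) = cong₂ _+_ (B-diagonal (suc s)) (B-vanish (ℕP.n<1+n s))

  B-+ : ∀ s j → B (s + j) s ≡ s C j
  B-+ zero    zero    = refl
  B-+ zero    (suc j) = refl
  B-+ (suc s) zero    = trans (cong (λ m → B (suc m) (suc s)) (ℕP.+-identityʳ s)) (B-diagonal (suc s))
  B-+ (suc s) (suc j) = begin
    B (suc (s + suc j)) (suc s)           ≡⟨ cong (λ m → B (suc m) (suc s)) (ℕP.+-suc s j) ⟩
    B (suc (s + j)) s + B (s + j) s       ≡⟨ cong₂ _+_ (trans (cong (λ m → B m s) (sym (ℕP.+-suc s j))) (B-+ s (suc j))) (B-+ s j) ⟩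
    s C suc j + s C j                     ≡⟨ ℕP.+-comm (s C suc j) (s C j) ⟩
    s C j + s C suc j                     ≡⟨ nCk+nC[k+1]≡[n+1]C[k+1] s j ⟩
    suc s C suc j                         ∎

  B≡C : ∀ {m s} → s ≤ m → B m s ≡ s C (m ∸ s)
  B≡C {m} {s} s≤m = trans (cong (λ k → B k s) (sym (ℕP.m+[n∸m]≡n s≤m))) (B-+ s (m ∸ s))

  [1+j]*sC[1+j]+j*sCj≡s*sCj : ∀ s j → suc j * (s C suc j) + j * (s C j) ≡ s * (s C j)
  [1+j]*sC[1+j]+j*sCj≡s*sCj s j = ℕP.+-cancelʳ-≡ (s C j) _ _ (begin
    suc j * (s C suc j) + j * (s C j) + s C j  ≡⟨ gather j (s C j) (s C suc j) ⟩
    suc j * (s C j + s C suc j)                ≡⟨ cong (suc j *_) (nCk+nC[k+1]≡[n+1]C[k+1] s j) ⟩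
    suc j * (suc s C suc j)                    ≡⟨ [1+k]*[1+n]C[1+k]≡[1+n]*nCk s j ⟩
    suc s * (s C j)                            ≡⟨ ℕP.+-comm (s C j) (s * (s C j)) ⟩
    s * (s C j) + s C j                        ∎)
    where
    gather : ∀ j X Y → suc j * Y + j * X + X ≡ suc j * (X + Y)
    gather = solve-∀

  -- (m + 1 − s) B (m + 1) s = (2s − m) B m s, with the negative terms moved across.
  B-ratio : ∀ m s → suc m * B (suc m) s + m * B m s ≡ s * B (suc m) s + 2 * s * B m s
  B-ratio m s with ℕP.<-cmp s (suc m)
  ... | tri< s<1+m _ _ = subst (λ m → suc m * B (suc m) s + m * B m s ≡ s * B (suc m) s + 2 * s * B m s)
                              (ℕP.m+[n∸m]≡n (ℕP.≤-pred s<1+m)) (ratio (m ∸ s))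
    where
    ratio : ∀ j → suc (s + j) * B (suc (s + j)) s + (s + j) * B (s + j) s
                ≡ s * B (suc (s + j)) s + 2 * s * B (s + j) s
    ratio j = begin
      suc (s + j) * B (suc (s + j)) s + (s + j) * B (s + j) s
        ≡⟨ cong₂ (λ p q → suc (s + j) * p + (s + j) * q) B-shifted (B-+ s j) ⟩
      suc (s + j) * (s C suc j) + (s + j) * (s C j)
        ≡⟨ regroup s j (s C j) (s C suc j) ⟩
      s * (s C suc j) + s * (s C j) + (suc j * (s C suc j) + j * (s C j))
        ≡⟨ cong (s * (s C suc j) + s * (s C j) +_) ([1+j]*sC[1+j]+j*sCj≡s*sCj s j) ⟩
      s * (s C suc j) + s * (s C j) + s * (s C j)
        ≡⟨ regroup′ s (s C j) (s C suc j) ⟩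
      s * (s C suc j) + 2 * s * (s C j)
        ≡⟨ cong₂ (λ p q → s * p + 2 * s * q) B-shifted (B-+ s j) ⟨
      s * B (suc (s + j)) s + 2 * s * B (s + j) s
        ∎
      where
      B-shifted : B (suc (s + j)) s ≡ s C suc j
      B-shifted = trans (cong (λ k → B k s) (sym (ℕP.+-suc s j))) (B-+ s (suc j))
      regroup : ∀ s j X Y → suc (s + j) * Y + (s + j) * X ≡ s * Y + s * X + (suc j * Y + j * X)
      regroup = solve-∀
      regroup′ : ∀ s X Y → s * Y + s * X + s * X ≡ s * Y + 2 * s * X
      regroup′ = solve-∀
  ... | tri≈ _ refl _ rewrite B-vanish (ℕP.n<1+n m) =
    cong (suc m * B (suc m) (suc m) +_) (trans (ℕP.*-zeroʳ m) (sym (ℕP.*-zeroʳ (2 * suc m))))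
  ... | tri> _ _ 1+m<s rewrite B-vanish 1+m<s | B-vanish (ℕP.<-trans (ℕP.n<1+n m) 1+m<s) =
    trans (cong₂ _+_ (ℕP.*-zeroʳ (suc m)) (ℕP.*-zeroʳ m)) (sym (cong₂ _+_ (ℕP.*-zeroʳ s) (ℕP.*-zeroʳ (2 * s))))

open Binomial

open import Data.Integer as ℤ using (+_)
import Data.Integer.Properties as ℤP
open import Data.Rational as ℚ using (ℚ; mkℚ; _/_; _+_; _*_; _-_; -_; 0ℚ; 1ℚ)
import Data.Rational.Properties as ℚP
import Data.Nat.Coprimality as Coprime
open import Relation.Nullary.Decidable using (dec⇒maybe)
open import Level using (0ℓ)
open import Tactic.RingSolver using (solve-∀; solve)
open import Tactic.RingSolver.Core.AlmostCommutativeRing using (AlmostCommutativeRing; fromCommutativeRing)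
open import Algebra.Properties.Group ℚP.+-0-group using (x∙y⁻¹≈ε⇒x≈y; ∙-cancelʳ; inverseˡ-unique)

ringℚ : AlmostCommutativeRing 0ℓ 0ℓ
ringℚ = fromCommutativeRing ℚP.+-*-commutativeRing (λ x → dec⇒maybe (0ℚ ℚP.≟ x))

two : ℚ
two = 1ℚ + 1ℚ

1/suc : ℕ → ℚ
1/suc k = + 1 / suc k

ℕtoℚ≡mkℚ : ∀ n → ℕtoℚ n ≡ mkℚ (+ n) 0 (Coprime.sym (Coprime.1-coprimeTo n))
ℕtoℚ≡mkℚ n = ℚP.normalize-coprime (Coprime.sym (Coprime.1-coprimeTo n))

1/suc≡mkℚ : ∀ k → 1/suc k ≡ mkℚ (+ 1) k (Coprime.1-coprimeTo (suc k))
1/suc≡mkℚ k = ℚP.normalize-coprime (Coprime.1-coprimeTo (suc k))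

ℕtoℚ-+ : ∀ m n → ℕtoℚ (m ℕ.+ n) ≡ ℕtoℚ m + ℕtoℚ n
ℕtoℚ-+ m n rewrite ℕtoℚ≡mkℚ m | ℕtoℚ≡mkℚ n =
  ℚP./-cong (trans (ℤP.pos-+ m n) (sym (cong₂ ℤ._+_ (ℤP.*-identityʳ (+ m)) (ℤP.*-identityʳ (+ n))))) refl

ℕtoℚ-* : ∀ m n → ℕtoℚ (m ℕ.* n) ≡ ℕtoℚ m * ℕtoℚ n
ℕtoℚ-* m n rewrite ℕtoℚ≡mkℚ m | ℕtoℚ≡mkℚ n = ℚP./-cong (ℤP.pos-* m n) refl

ℕtoℚ-suc : ∀ n → ℕtoℚ (suc n) ≡ ℕtoℚ n + 1ℚ
ℕtoℚ-suc n = trans (cong ℕtoℚ (ℕP.+-comm 1 n)) (ℕtoℚ-+ n 1)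

1/suc-inverseˡ : ∀ k → 1/suc k * ℕtoℚ (suc k) ≡ 1ℚ
1/suc-inverseˡ k rewrite 1/suc≡mkℚ k | ℕtoℚ≡mkℚ (suc k) =
  ℚP.*-inverseˡ (mkℚ (+ suc k) 0 (Coprime.sym (Coprime.1-coprimeTo (suc k))))

ℕtoℚ-suc-cancelˡ : ∀ k {x} → ℕtoℚ (suc k) * x ≡ 0ℚ → x ≡ 0ℚ
ℕtoℚ-suc-cancelˡ k {x} kx≡0 = begin
  x                               ≡⟨ sym (ℚP.*-identityˡ x) ⟩
  1ℚ * x                          ≡⟨ cong (_* x) (sym (1/suc-inverseˡ k)) ⟩
  1/suc k * ℕtoℚ (suc k) * x      ≡⟨ ℚP.*-assoc (1/suc k) (ℕtoℚ (suc k)) x ⟩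
  1/suc k * (ℕtoℚ (suc k) * x)    ≡⟨ cong (1/suc k *_) kx≡0 ⟩
  1/suc k * 0ℚ                    ≡⟨ ℚP.*-zeroʳ (1/suc k) ⟩
  0ℚ                              ∎

two/suc : ∀ m → (+ 2) / suc m ≡ two * 1/suc m
two/suc m rewrite 1/suc≡mkℚ m =
  ℚP./-cong {+ 2} {suc m} {+ 2 ℤ.* + 1} {1 ℕ.* suc m} refl (cong suc (sym (ℕP.+-identityʳ m)))

H2-increment : ∀ k → H2 (suc k) ≡ H2 k + 1/suc k * 1/suc k
H2-increment k rewrite 1/suc≡mkℚ k = refl

-- The ring solver cannot use hypotheses; to derive L ≡ R from relations aᵢ ≡ bᵢ it instead checks that
-- L − R is the combination Σ lᵢ (aᵢ − bᵢ).
by-relations₂ : ∀ {L R a₁ b₁ a₂ b₂} (l₁ l₂ : ℚ) → a₁ ≡ b₁ → a₂ ≡ b₂ →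
  L ≡ R + (l₁ * (a₁ - b₁) + l₂ * (a₂ - b₂)) → L ≡ R
by-relations₂ {R = R} {b₁ = b₁} {b₂ = b₂} l₁ l₂ refl refl eq = trans eq (vanish R l₁ l₂ b₁ b₂)
  where
  vanish : ∀ R l₁ l₂ b₁ b₂ → R + (l₁ * (b₁ - b₁) + l₂ * (b₂ - b₂)) ≡ R
  vanish = solve-∀ ringℚ

by-relations₃ : ∀ {L R a₁ b₁ a₂ b₂ a₃ b₃} (l₁ l₂ l₃ : ℚ) → a₁ ≡ b₁ → a₂ ≡ b₂ → a₃ ≡ b₃ →
  L ≡ R + (l₁ * (a₁ - b₁) + l₂ * (a₂ - b₂) + l₃ * (a₃ - b₃)) → L ≡ R
by-relations₃ {R = R} {b₁ = b₁} {b₂ = b₂} {b₃ = b₃} l₁ l₂ l₃ refl refl refl eq = trans eq (vanish R l₁ l₂ l₃ b₁ b₂ b₃)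
  where
  vanish : ∀ R l₁ l₂ l₃ b₁ b₂ b₃ → R + (l₁ * (b₁ - b₁) + l₂ * (b₂ - b₂) + l₃ * (b₃ - b₃)) ≡ R
  vanish = solve-∀ ringℚ

0-second-factor : ∀ p q r → p * 0ℚ * q * r ≡ 0ℚ
0-second-factor = solve-∀ ringℚ

0-third-factor : ∀ p q r → p * q * 0ℚ * r ≡ 0ℚ
0-third-factor = solve-∀ ringℚ

recurrence-unique : ∀ (f : ℚ → ℚ → ℚ) (r : ℕ → ℚ) {u v : ℕ → ℚ} →
  (∀ n → u (2 ℕ.+ n) + f (u (1 ℕ.+ n)) (u n) ≡ r n) →
  (∀ n → v (2 ℕ.+ n) + f (v (1 ℕ.+ n)) (v n) ≡ r n) →
  u 0 ≡ v 0 → u 1 ≡ v 1 → ∀ n → u n ≡ v n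
recurrence-unique f r {u} {v} u-rec v-rec u₀≡v₀ u₁≡v₁ n = proj₁ (agree n)
  where
  agree : ∀ n → u n ≡ v n × u (suc n) ≡ v (suc n)
  agree zero    = u₀≡v₀ , u₁≡v₁
  agree (suc n) with agree n
  ... | uₙ≡vₙ , uₙ₊₁≡vₙ₊₁ = uₙ₊₁≡vₙ₊₁ , ∙-cancelʳ (f (u (1 ℕ.+ n)) (u n)) (u (2 ℕ.+ n)) (v (2 ℕ.+ n)) (begin
    u (2 ℕ.+ n) + f (u (1 ℕ.+ n)) (u n)  ≡⟨ u-rec n ⟩
    r n                                  ≡⟨ v-rec n ⟨
    v (2 ℕ.+ n) + f (v (1 ℕ.+ n)) (v n)  ≡⟨ cong (λ t → v (2 ℕ.+ n) + t) (cong₂ f uₙ₊₁≡vₙ₊₁ uₙ≡vₙ) ⟨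
    v (2 ℕ.+ n) + f (u (1 ℕ.+ n)) (u n)  ∎)

sumTo-cong : ∀ n {f g : ℕ → ℚ} → (∀ s → s ≤ n → f s ≡ g s) → sumTo n f ≡ sumTo n g
sumTo-cong zero    f≗g = f≗g 0 z≤n
sumTo-cong (suc n) f≗g =
  cong₂ _+_ (sumTo-cong n (λ s s≤n → f≗g s (ℕP.m≤n⇒m≤1+n s≤n))) (f≗g (suc n) ℕP.≤-refl)

sumTo-+ : ∀ n (f g : ℕ → ℚ) → sumTo n (λ s → f s + g s) ≡ sumTo n f + sumTo n g
sumTo-+ zero    f g = refl
sumTo-+ (suc n) f g = trans (cong (_+ (f (suc n) + g (suc n))) (sumTo-+ n f g))
                            (interchange (sumTo n f) (sumTo n g) (f (suc n)) (g (suc n)))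
  where
  interchange : ∀ a b c d → a + b + (c + d) ≡ a + c + (b + d)
  interchange = solve-∀ ringℚ

sumTo-*ˡ : ∀ n a (f : ℕ → ℚ) → sumTo n (λ s → a * f s) ≡ a * sumTo n f
sumTo-*ˡ zero    a f = refl
sumTo-*ˡ (suc n) a f = trans (cong (_+ (a * f (suc n))) (sumTo-*ˡ n a f))
                             (sym (ℚP.*-distribˡ-+ a (sumTo n f) (f (suc n))))

sumTo-telescope : ∀ n (g : ℕ → ℚ) → sumTo n (λ s → g s - g (suc s)) ≡ g 0 - g (suc n)
sumTo-telescope zero    g = refl
sumTo-telescope (suc n) g = trans (cong (_+ (g (suc n) - g (suc (suc n)))) (sumTo-telescope n g))
                                  (collapse (g 0) (g (suc n)) (g (suc (suc n))))
  where
  collapse : ∀ a b c → a - b + (b - c) ≡ a - c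
  collapse = solve-∀ ringℚ

sumTo-by-parts : ∀ n (h q : ℕ → ℚ) →
  sumTo n (λ s → h s * (q s - q (suc s)))
    ≡ h 0 * q 0 - h (suc n) * q (suc n) + sumTo n (λ s → q (suc s) * (h (suc s) - h s))
sumTo-by-parts n h q = begin
  sumTo n (λ s → h s * (q s - q (suc s)))
    ≡⟨ sumTo-cong n (λ s _ → split (h s) (h (suc s)) (q s) (q (suc s))) ⟩
  sumTo n (λ s → (hq s - hq (suc s)) + q (suc s) * (h (suc s) - h s))
    ≡⟨ sumTo-+ n (λ s → hq s - hq (suc s)) (λ s → q (suc s) * (h (suc s) - h s)) ⟩
  sumTo n (λ s → hq s - hq (suc s)) + sumTo n (λ s → q (suc s) * (h (suc s) - h s))
    ≡⟨ cong (_+ sumTo n (λ s → q (suc s) * (h (suc s) - h s))) (sumTo-telescope n hq) ⟩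
  h 0 * q 0 - h (suc n) * q (suc n) + sumTo n (λ s → q (suc s) * (h (suc s) - h s))
    ∎
  where
  hq : ℕ → ℚ
  hq s = h s * q s
  split : ∀ h₀ h₁ q₀ q₁ → h₀ * (q₀ - q₁) ≡ (h₀ * q₀ - h₁ * q₁) + q₁ * (h₁ - h₀)
  split = solve-∀ ringℚ

sumTo-vanishing : ∀ {m n} {f : ℕ → ℚ} → (∀ s → m < s → f s ≡ 0ℚ) → m ≤ n → sumTo n f ≡ sumTo m f
sumTo-vanishing {n = zero}  f≡0 z≤n = refl
sumTo-vanishing {m} {suc n} {f} f≡0 m≤1+n with ℕP.m≤n⇒m<n∨m≡n m≤1+n
... | inj₂ refl  = refl
... | inj₁ m<1+n = begin
  sumTo n f + f (suc n)  ≡⟨ cong (λ t → sumTo n f + t) (f≡0 (suc n) m<1+n) ⟩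
  sumTo n f + 0ℚ         ≡⟨ ℚP.+-identityʳ (sumTo n f) ⟩
  sumTo n f              ≡⟨ sumTo-vanishing f≡0 (ℕP.≤-pred m<1+n) ⟩
  sumTo m f              ∎

sumTo-combination : ∀ n a (f g h : ℕ → ℚ) →
  sumTo n (λ s → f s + (a * g s + h s)) ≡ sumTo n f + (a * sumTo n g + sumTo n h)
sumTo-combination n a f g h = begin
  sumTo n (λ s → f s + (a * g s + h s))                     ≡⟨ sumTo-+ n f (λ s → a * g s + h s) ⟩
  sumTo n f + sumTo n (λ s → a * g s + h s)                 ≡⟨ cong (λ t → sumTo n f + t) (sumTo-+ n (λ s → a * g s) h) ⟩
  sumTo n f + (sumTo n (λ s → a * g s) + sumTo n h)         ≡⟨ cong (λ t → sumTo n f + (t + sumTo n h)) (sumTo-*ˡ n a g) ⟩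
  sumTo n f + (a * sumTo n g + sumTo n h)                   ∎

central : ℕ → ℚ
central s = ℕtoℚ ((2 ℕ.* s) C s)

b : ℕ → ℕ → ℚ
b m s = ℕtoℚ (B m s)

ℕtoℚ-*+* : ∀ p q r t → ℕtoℚ (p ℕ.* q ℕ.+ r ℕ.* t) ≡ ℕtoℚ p * ℕtoℚ q + ℕtoℚ r * ℕtoℚ t
ℕtoℚ-*+* p q r t = trans (ℕtoℚ-+ (p ℕ.* q) (r ℕ.* t)) (cong₂ _+_ (ℕtoℚ-* p q) (ℕtoℚ-* r t))

central-step : ∀ s → ℕtoℚ (suc s) * central (suc s) ≡ two * (two * ℕtoℚ s + 1ℚ) * central s
central-step s = begin
  ℕtoℚ (suc s) * central (suc s)                   ≡⟨ ℕtoℚ-* (suc s) ((2 ℕ.* suc s) C suc s) ⟨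
  ℕtoℚ (suc s ℕ.* ((2 ℕ.* suc s) C suc s))         ≡⟨ cong ℕtoℚ ([1+n]*[2+2n]C[1+n]≡2*[1+2n]*[2n]Cn s) ⟩
  ℕtoℚ (2 ℕ.* suc (2 ℕ.* s) ℕ.* ((2 ℕ.* s) C s))   ≡⟨ ℕtoℚ-* (2 ℕ.* suc (2 ℕ.* s)) ((2 ℕ.* s) C s) ⟩
  ℕtoℚ (2 ℕ.* suc (2 ℕ.* s)) * central s           ≡⟨ cong (_* central s) odd ⟩
  two * (two * ℕtoℚ s + 1ℚ) * central s            ∎
  where
  odd : ℕtoℚ (2 ℕ.* suc (2 ℕ.* s)) ≡ two * (two * ℕtoℚ s + 1ℚ)
  odd = trans (ℕtoℚ-* 2 (suc (2 ℕ.* s)))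
              (cong (two *_) (trans (ℕtoℚ-suc (2 ℕ.* s)) (cong (_+ 1ℚ) (ℕtoℚ-* 2 s))))

b-vanish : ∀ {m s} → m < s → b m s ≡ 0ℚ
b-vanish m<s = cong ℕtoℚ (B-vanish m<s)

b-step : ∀ m s → b (2 ℕ.+ m) (suc s) ≡ b (1 ℕ.+ m) s + b m s
b-step m s = ℕtoℚ-+ (B (suc m) s) (B m s)

b-ratio : ∀ m s → ℕtoℚ (suc m) * b (suc m) s + ℕtoℚ m * b m s ≡ ℕtoℚ s * b (suc m) s + two * ℕtoℚ s * b m s
b-ratio m s = begin
  ℕtoℚ (suc m) * b (suc m) s + ℕtoℚ m * b m s          ≡⟨ ℕtoℚ-*+* (suc m) (B (suc m) s) m (B m s) ⟨
  ℕtoℚ (suc m ℕ.* B (suc m) s ℕ.+ m ℕ.* B m s)         ≡⟨ cong ℕtoℚ (B-ratio m s) ⟩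
  ℕtoℚ (s ℕ.* B (suc m) s ℕ.+ 2 ℕ.* s ℕ.* B m s)       ≡⟨ ℕtoℚ-*+* s (B (suc m) s) (2 ℕ.* s) (B m s) ⟩
  ℕtoℚ s * b (suc m) s + ℕtoℚ (2 ℕ.* s) * b m s        ≡⟨ cong (λ t → ℕtoℚ s * b (suc m) s + t * b m s) (ℕtoℚ-* 2 s) ⟩
  ℕtoℚ s * b (suc m) s + two * ℕtoℚ s * b m s          ∎

b-recurrence₃ : ∀ n s →
  ℕtoℚ (2 ℕ.+ n) * (ℕtoℚ (3 ℕ.+ n) * b (2 ℕ.+ n) s + (two * (ℕtoℚ (2 ℕ.+ n) * b (1 ℕ.+ n) s) + ℕtoℚ (1 ℕ.+ n) * b n s))
    ≡ ℕtoℚ s * ℕtoℚ (suc s) * b (2 ℕ.+ n) s + two * ℕtoℚ (suc s) * (two * ℕtoℚ s + 1ℚ) * b (2 ℕ.+ n) (suc s)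
b-recurrence₃ n s =
  identity (ℕtoℚ n) (ℕtoℚ (1 ℕ.+ n)) (ℕtoℚ (2 ℕ.+ n)) (ℕtoℚ (3 ℕ.+ n)) (ℕtoℚ s) (ℕtoℚ (suc s))
           (b (2 ℕ.+ n) s) (b (1 ℕ.+ n) s) (b n s) (b (2 ℕ.+ n) (suc s))
           (ℕtoℚ-suc n) (ℕtoℚ-suc (1 ℕ.+ n)) (ℕtoℚ-suc (2 ℕ.+ n)) (ℕtoℚ-suc s) (b-step n s)
           (b-ratio (1 ℕ.+ n) s) (b-ratio n s)
  where
  identity : ∀ N₀ N₁ N₂ N₃ S S₁ x y z x′ →
    N₁ ≡ N₀ + 1ℚ → N₂ ≡ N₁ + 1ℚ → N₃ ≡ N₂ + 1ℚ → S₁ ≡ S + 1ℚ → x′ ≡ y + z →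
    N₂ * x + N₁ * y ≡ S * x + two * S * y → N₁ * y + N₀ * z ≡ S * y + two * S * z →
    N₂ * (N₃ * x + (two * (N₂ * y) + N₁ * z)) ≡ S * S₁ * x + two * S₁ * (two * S + 1ℚ) * x′
  identity N₀ _ _ _ S _ x y z _ refl refl refl refl refl r₁ r₂ =
    by-relations₂ (N₀ + S + 1ℚ + two) (N₀ + two * S + 1ℚ + two) r₁ r₂ (solve (N₀ ∷ S ∷ x ∷ y ∷ z ∷ []) ringℚ)

weight : ℕ → ℕ → ℚ
weight m s = central s * b m s * sign s * 1/suc s

weightTelescoper : ℕ → ℕ → ℚ
weightTelescoper m k = sign k * central k * b m k * ℕtoℚ k

weight-telescoping : ∀ n s →
  ℕtoℚ (2 ℕ.+ n) * (ℕtoℚ (3 ℕ.+ n) * weight (2 ℕ.+ n) s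
                    + (two * (ℕtoℚ (2 ℕ.+ n) * weight (1 ℕ.+ n) s) + ℕtoℚ (1 ℕ.+ n) * weight n s))
    ≡ weightTelescoper (2 ℕ.+ n) s - weightTelescoper (2 ℕ.+ n) (suc s)
weight-telescoping n s =
  identity (ℕtoℚ (1 ℕ.+ n)) (ℕtoℚ (2 ℕ.+ n)) (ℕtoℚ (3 ℕ.+ n)) (ℕtoℚ s) (ℕtoℚ (suc s))
           (b (2 ℕ.+ n) s) (b (1 ℕ.+ n) s) (b n s) (b (2 ℕ.+ n) (suc s)) (sign s) (central s) (central (suc s)) (1/suc s)
           (b-recurrence₃ n s) (central-step s) (1/suc-inverseˡ s)
  where
  identity : ∀ N₁ N₂ N₃ S S₁ x y z x′ σ c c′ i →
    N₂ * (N₃ * x + (two * (N₂ * y) + N₁ * z)) ≡ S * S₁ * x + two * S₁ * (two * S + 1ℚ) * x′ →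
    S₁ * c′ ≡ two * (two * S + 1ℚ) * c → i * S₁ ≡ 1ℚ →
    N₂ * (N₃ * (c * x * σ * i) + (two * (N₂ * (c * y * σ * i)) + N₁ * (c * z * σ * i)))
      ≡ σ * c * x * S - (- σ) * c′ * x′ * S₁
  identity N₁ N₂ N₃ S S₁ x y z x′ σ c c′ i r₁ r₂ r₃ =
    by-relations₃ (σ * c * i) (- (σ * x′)) (σ * c * x * S + σ * x′ * two * (two * S + 1ℚ) * c) r₁ r₂ r₃
      (solve (N₁ ∷ N₂ ∷ N₃ ∷ S ∷ S₁ ∷ x ∷ y ∷ z ∷ x′ ∷ σ ∷ c ∷ c′ ∷ i ∷ []) ringℚ)

b-recurrence₂ : ∀ n k →
  ℕtoℚ (suc k) * (ℕtoℚ (2 ℕ.+ n) * (ℕtoℚ (2 ℕ.+ n) * b (2 ℕ.+ n) k + ℕtoℚ (1 ℕ.+ n) * b (1 ℕ.+ n) k))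
    ≡ ℕtoℚ k * ℕtoℚ (suc k) * (two * ℕtoℚ k - ℕtoℚ (2 ℕ.+ n)) * b (2 ℕ.+ n) k
      + two * ℕtoℚ k * (two * ℕtoℚ k + 1ℚ) * (two * ℕtoℚ (suc k) - ℕtoℚ (2 ℕ.+ n)) * b (2 ℕ.+ n) (suc k)
b-recurrence₂ n k =
  identity (ℕtoℚ n) (ℕtoℚ (1 ℕ.+ n)) (ℕtoℚ (2 ℕ.+ n)) (ℕtoℚ k) (ℕtoℚ (suc k))
           (b (2 ℕ.+ n) k) (b (1 ℕ.+ n) k) (b n k) (b (2 ℕ.+ n) (suc k))
           (ℕtoℚ-suc n) (ℕtoℚ-suc (1 ℕ.+ n)) (ℕtoℚ-suc k) (b-step n k) (b-ratio (1 ℕ.+ n) k) (b-ratio n k)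
  where
  identity : ∀ N₀ N₁ N₂ K K₁ x y z x′ →
    N₁ ≡ N₀ + 1ℚ → N₂ ≡ N₁ + 1ℚ → K₁ ≡ K + 1ℚ → x′ ≡ y + z →
    N₂ * x + N₁ * y ≡ K * x + two * K * y → N₁ * y + N₀ * z ≡ K * y + two * K * z →
    K₁ * (N₂ * (N₂ * x + N₁ * y))
      ≡ K * K₁ * (two * K - N₂) * x + two * K * (two * K + 1ℚ) * (two * K₁ - N₂) * x′
  identity N₀ _ _ K _ x y z _ refl refl refl refl r₁ r₂ =
    by-relations₂ ((K + 1ℚ) * (N₀ + two + two * K)) (two * K * (two * K + 1ℚ)) r₁ r₂
      (solve (N₀ ∷ K ∷ x ∷ y ∷ z ∷ []) ringℚ)

tailWeight : ℕ → ℕ → ℚ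
tailWeight m s = sign (suc s) * central (suc s) * b m (suc s) * 1/suc s

tailTelescoper : ℕ → ℕ → ℚ
tailTelescoper m k = sign k * central k * b m k * (two * ℕtoℚ k - ℕtoℚ m)

tail-telescoping : ∀ n s →
  ℕtoℚ (2 ℕ.+ n) * (ℕtoℚ (2 ℕ.+ n) * tailWeight (2 ℕ.+ n) s + ℕtoℚ (1 ℕ.+ n) * tailWeight (1 ℕ.+ n) s)
    ≡ tailTelescoper (2 ℕ.+ n) (suc s) - tailTelescoper (2 ℕ.+ n) (2 ℕ.+ s)
tail-telescoping n s = x∙y⁻¹≈ε⇒x≈y _ _ (ℕtoℚ-suc-cancelˡ (suc s)
  (identity (ℕtoℚ (1 ℕ.+ n)) (ℕtoℚ (2 ℕ.+ n)) (ℕtoℚ (suc s)) (ℕtoℚ (2 ℕ.+ s))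
            (b (2 ℕ.+ n) (suc s)) (b (1 ℕ.+ n) (suc s)) (b (2 ℕ.+ n) (2 ℕ.+ s))
            (sign s) (central (suc s)) (central (2 ℕ.+ s)) (1/suc s)
            (b-recurrence₂ n (suc s)) (central-step (suc s)) (1/suc-inverseˡ s)))
  where
  identity : ∀ N₁ N₂ K K₁ x y x′ σ c c′ i →
    K₁ * (N₂ * (N₂ * x + N₁ * y))
      ≡ K * K₁ * (two * K - N₂) * x + two * K * (two * K + 1ℚ) * (two * K₁ - N₂) * x′ →
    K₁ * c′ ≡ two * (two * K + 1ℚ) * c → i * K ≡ 1ℚ →
    K₁ * (N₂ * (N₂ * ((- σ) * c * x * i) + N₁ * ((- σ) * c * y * i))
          - ((- σ) * c * x * (two * K - N₂) - (- (- σ)) * c′ * x′ * (two * K₁ - N₂)))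
      ≡ 0ℚ
  identity N₁ N₂ K K₁ x y x′ σ c c′ i r₁ r₂ r₃ =
    by-relations₃ ((- σ) * c * i) (x′ * (two * K₁ - N₂) * σ)
      (- (σ * c * x * K₁ * (two * K - N₂) + σ * x′ * (two * K₁ - N₂) * two * (two * K + 1ℚ) * c)) r₁ r₂ r₃
      (solve (N₁ ∷ N₂ ∷ K ∷ K₁ ∷ x ∷ y ∷ x′ ∷ σ ∷ c ∷ c′ ∷ i ∷ []) ringℚ)

weight-vanish : ∀ {m s} → m < s → weight m s ≡ 0ℚ
weight-vanish {m} {s} m<s = trans (cong (λ t → central s * t * sign s * 1/suc s) (b-vanish m<s))
                                  (0-second-factor (central s) (sign s) (1/suc s))

weightTelescoper-vanish : ∀ {m k} → m < k → weightTelescoper m k ≡ 0ℚ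
weightTelescoper-vanish {m} {k} m<k = trans (cong (λ t → sign k * central k * t * ℕtoℚ k) (b-vanish m<k))
                                      (0-third-factor (sign k) (central k) (ℕtoℚ k))

tailWeight-vanish : ∀ {m s} → m ≤ s → tailWeight m s ≡ 0ℚ
tailWeight-vanish {m} {s} m≤s = trans (cong (λ t → sign (suc s) * central (suc s) * t * 1/suc s) (b-vanish (s≤s m≤s)))
                                      (0-third-factor (sign (suc s)) (central (suc s)) (1/suc s))

tailTelescoper-vanish : ∀ {m k} → m < k → tailTelescoper m k ≡ 0ℚ
tailTelescoper-vanish {m} {k} m<k = trans (cong (λ t → sign k * central k * t * (two * ℕtoℚ k - ℕtoℚ m)) (b-vanish m<k))
                                          (0-third-factor (sign k) (central k) (two * ℕtoℚ k - ℕtoℚ m))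

lhs : ℕ → ℚ
lhs m = sumTo m (λ s → weight m s * H2 s)

scaledLhs : ℕ → ℚ
scaledLhs k = ℕtoℚ (suc k) * lhs k

scaledRhs : ℕ → ℚ
scaledRhs k = two * sign k * sumTo k H2

tailSum : ℕ → ℚ
tailSum m = sumTo m (tailWeight m)

recurrence : (ℕ → ℚ) → ℕ → ℚ
recurrence u n = u (2 ℕ.+ n) + (two * u (1 ℕ.+ n) + u n)

forcing : ℕ → ℚ
forcing n = two * sign (2 ℕ.+ n) * (1/suc (1 ℕ.+ n) * 1/suc (1 ℕ.+ n))

scaledLhs≡sumTo : ∀ k {M} → k ≤ M → scaledLhs k ≡ sumTo M (λ s → ℕtoℚ (suc k) * (weight k s * H2 s))
scaledLhs≡sumTo k {M} k≤M = begin
  ℕtoℚ (suc k) * lhs k                                  ≡⟨ sumTo-*ˡ k (ℕtoℚ (suc k)) (λ s → weight k s * H2 s) ⟨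
  sumTo k (λ s → ℕtoℚ (suc k) * (weight k s * H2 s))    ≡⟨ sumTo-vanishing vanish k≤M ⟨
  sumTo M (λ s → ℕtoℚ (suc k) * (weight k s * H2 s))    ∎
  where
  vanish : ∀ s → k < s → ℕtoℚ (suc k) * (weight k s * H2 s) ≡ 0ℚ
  vanish s k<s = begin
    ℕtoℚ (suc k) * (weight k s * H2 s)  ≡⟨ cong (λ t → ℕtoℚ (suc k) * (t * H2 s)) (weight-vanish k<s) ⟩
    ℕtoℚ (suc k) * (0ℚ * H2 s)          ≡⟨ cong (ℕtoℚ (suc k) *_) (ℚP.*-zeroˡ (H2 s)) ⟩
    ℕtoℚ (suc k) * 0ℚ                   ≡⟨ ℚP.*-zeroʳ (ℕtoℚ (suc k)) ⟩
    0ℚ                                  ∎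

weightTelescoper-increment : ∀ m s → weightTelescoper m (suc s) * (H2 (suc s) - H2 s) ≡ tailWeight m s
weightTelescoper-increment m s = begin
  a * ℕtoℚ (suc s) * (H2 (suc s) - H2 s)            ≡⟨ cong (λ t → a * ℕtoℚ (suc s) * (t - H2 s)) (H2-increment s) ⟩
  a * ℕtoℚ (suc s) * (H2 s + 1/suc s * 1/suc s - H2 s) ≡⟨ regroup a (ℕtoℚ (suc s)) (H2 s) (1/suc s) ⟩
  a * 1/suc s * (1/suc s * ℕtoℚ (suc s))          ≡⟨ cong (a * 1/suc s *_) (1/suc-inverseˡ s) ⟩
  a * 1/suc s * 1ℚ                                ≡⟨ ℚP.*-identityʳ (a * 1/suc s) ⟩
  tailWeight m s                                  ∎
  where
  a = sign (suc s) * central (suc s) * b m (suc s)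
  regroup : ∀ a K h i → a * K * (h + i * i - h) ≡ a * i * (i * K)
  regroup = solve-∀ ringℚ

recurrence-scaledLhs≡tailSum : ∀ n → ℕtoℚ (2 ℕ.+ n) * recurrence scaledLhs n ≡ tailSum (2 ℕ.+ n)
recurrence-scaledLhs≡tailSum n = begin
  ℕtoℚ M * (scaledLhs M + (two * scaledLhs (1 ℕ.+ n) + scaledLhs n))
    ≡⟨ cong (ℕtoℚ M *_) (cong₂ _+_
         (scaledLhs≡sumTo M ℕP.≤-refl)
         (cong₂ (λ p q → two * p + q) (scaledLhs≡sumTo (1 ℕ.+ n) (ℕP.n≤1+n (1 ℕ.+ n)))
                                      (scaledLhs≡sumTo n (ℕP.m≤n+m n 2)))) ⟩
  ℕtoℚ M * (sumTo M (g M) + (two * sumTo M (g (1 ℕ.+ n)) + sumTo M (g n)))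
    ≡⟨ cong (ℕtoℚ M *_) (sumTo-combination M two (g M) (g (1 ℕ.+ n)) (g n)) ⟨
  ℕtoℚ M * sumTo M (λ s → g M s + (two * g (1 ℕ.+ n) s + g n s))
    ≡⟨ sumTo-*ˡ M (ℕtoℚ M) (λ s → g M s + (two * g (1 ℕ.+ n) s + g n s)) ⟨
  sumTo M (λ s → ℕtoℚ M * (g M s + (two * g (1 ℕ.+ n) s + g n s)))
    ≡⟨ sumTo-cong M (λ s _ → pointwise s) ⟩
  sumTo M (λ s → H2 s * (weightTelescoper M s - weightTelescoper M (suc s)))
    ≡⟨ sumTo-by-parts M H2 (weightTelescoper M) ⟩
  0ℚ * weightTelescoper M 0 - H2 (suc M) * weightTelescoper M (suc M) + sumTo M increments
    ≡⟨ cong (λ t → 0ℚ * weightTelescoper M 0 - H2 (suc M) * t + sumTo M increments) (weightTelescoper-vanish (ℕP.n<1+n M)) ⟩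
  0ℚ * weightTelescoper M 0 - H2 (suc M) * 0ℚ + sumTo M increments
    ≡⟨ boundary (weightTelescoper M 0) (H2 (suc M)) (sumTo M increments) ⟩
  sumTo M increments
    ≡⟨ sumTo-cong M (λ s _ → weightTelescoper-increment M s) ⟩
  tailSum M
    ∎
  where
  M = 2 ℕ.+ n
  g : ℕ → ℕ → ℚ
  g k s = ℕtoℚ (suc k) * (weight k s * H2 s)
  increments : ℕ → ℚ
  increments s = weightTelescoper M (suc s) * (H2 (suc s) - H2 s)
  factor : ∀ N₁ N₂ N₃ w₀ w₁ w₂ h →
    N₂ * (N₃ * (w₂ * h) + (two * (N₂ * (w₁ * h)) + N₁ * (w₀ * h)))
      ≡ h * (N₂ * (N₃ * w₂ + (two * (N₂ * w₁) + N₁ * w₀)))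
  factor = solve-∀ ringℚ
  pointwise : ∀ s → ℕtoℚ M * (g M s + (two * g (1 ℕ.+ n) s + g n s))
                    ≡ H2 s * (weightTelescoper M s - weightTelescoper M (suc s))
  pointwise s = trans (factor (ℕtoℚ (1 ℕ.+ n)) (ℕtoℚ M) (ℕtoℚ (3 ℕ.+ n)) (weight n s) (weight (1 ℕ.+ n) s) (weight M s) (H2 s))
                      (cong (H2 s *_) (weight-telescoping n s))
  boundary : ∀ q h S → 0ℚ * q - h * 0ℚ + S ≡ S
  boundary = solve-∀ ringℚ

tailSum-recurrence : ∀ n → ℕtoℚ (2 ℕ.+ n) * tailSum (2 ℕ.+ n) + ℕtoℚ (1 ℕ.+ n) * tailSum (1 ℕ.+ n) ≡ 0ℚ
tailSum-recurrence n = ℕtoℚ-suc-cancelˡ (1 ℕ.+ n) (begin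
  ℕtoℚ M * (ℕtoℚ M * tailSum M + ℕtoℚ (1 ℕ.+ n) * tailSum (1 ℕ.+ n))
    ≡⟨ cong (λ t → ℕtoℚ M * (ℕtoℚ M * tailSum M + ℕtoℚ (1 ℕ.+ n) * t))
            (sym (sumTo-vanishing (λ s 1+n<s → tailWeight-vanish (ℕP.<⇒≤ 1+n<s)) (ℕP.n≤1+n (1 ℕ.+ n)))) ⟩
  ℕtoℚ M * (ℕtoℚ M * tailSum M + ℕtoℚ (1 ℕ.+ n) * sumTo M (tailWeight (1 ℕ.+ n)))
    ≡⟨ cong (ℕtoℚ M *_) (cong₂ _+_ (sumTo-*ˡ M (ℕtoℚ M) (tailWeight M))
                                    (sumTo-*ˡ M (ℕtoℚ (1 ℕ.+ n)) (tailWeight (1 ℕ.+ n)))) ⟨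
  ℕtoℚ M * (sumTo M (λ s → ℕtoℚ M * tailWeight M s) + sumTo M (λ s → ℕtoℚ (1 ℕ.+ n) * tailWeight (1 ℕ.+ n) s))
    ≡⟨ cong (ℕtoℚ M *_) (sumTo-+ M (λ s → ℕtoℚ M * tailWeight M s) (λ s → ℕtoℚ (1 ℕ.+ n) * tailWeight (1 ℕ.+ n) s)) ⟨
  ℕtoℚ M * sumTo M (λ s → ℕtoℚ M * tailWeight M s + ℕtoℚ (1 ℕ.+ n) * tailWeight (1 ℕ.+ n) s)
    ≡⟨ sumTo-*ˡ M (ℕtoℚ M) (λ s → ℕtoℚ M * tailWeight M s + ℕtoℚ (1 ℕ.+ n) * tailWeight (1 ℕ.+ n) s) ⟨
  sumTo M (λ s → ℕtoℚ M * (ℕtoℚ M * tailWeight M s + ℕtoℚ (1 ℕ.+ n) * tailWeight (1 ℕ.+ n) s))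
    ≡⟨ sumTo-cong M (λ s _ → tail-telescoping n s) ⟩
  sumTo M (λ s → tailTelescoper M (suc s) - tailTelescoper M (2 ℕ.+ s))
    ≡⟨ sumTo-telescope M (λ k → tailTelescoper M (suc k)) ⟩
  tailTelescoper M 1 - tailTelescoper M (2 ℕ.+ M)
    ≡⟨ cong₂ _-_ (tailTelescoper-at-1 n) (tailTelescoper-vanish (ℕP.<-trans (ℕP.n<1+n M) (ℕP.n<1+n (suc M)))) ⟩
  0ℚ - 0ℚ
    ≡⟨⟩
  0ℚ
    ∎)
  where
  M = 2 ℕ.+ n
  -- For M = 2 the factor 2·1 − M vanishes; for M > 2 the binomial C(1, M − 1) does.
  tailTelescoper-at-1 : ∀ n → tailTelescoper (2 ℕ.+ n) 1 ≡ 0ℚ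
  tailTelescoper-at-1 zero    = refl
  tailTelescoper-at-1 (suc n) = ℚP.*-zeroˡ (two * ℕtoℚ 1 - ℕtoℚ (3 ℕ.+ n))

tailSum-closed : ∀ k → ℕtoℚ (suc k) * tailSum (suc k) ≡ two * sign (suc k)
tailSum-closed zero    = refl
tailSum-closed (suc k) = begin
  ℕtoℚ (2 ℕ.+ k) * tailSum (2 ℕ.+ k)
    ≡⟨ inverseˡ-unique (ℕtoℚ (2 ℕ.+ k) * tailSum (2 ℕ.+ k)) (ℕtoℚ (1 ℕ.+ k) * tailSum (1 ℕ.+ k)) (tailSum-recurrence k) ⟩
  - (ℕtoℚ (1 ℕ.+ k) * tailSum (1 ℕ.+ k))  ≡⟨ cong -_ (tailSum-closed k) ⟩
  - (two * sign (suc k))                  ≡⟨ ℚP.neg-distribʳ-* two (sign (suc k)) ⟩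
  two * sign (2 ℕ.+ k)                    ∎

scaledLhs-recurrence : ∀ n → recurrence scaledLhs n ≡ forcing n
scaledLhs-recurrence n = x∙y⁻¹≈ε⇒x≈y _ _ (ℕtoℚ-suc-cancelˡ (1 ℕ.+ n) (ℕtoℚ-suc-cancelˡ (1 ℕ.+ n)
  (identity (ℕtoℚ (2 ℕ.+ n)) (recurrence scaledLhs n) (sign n) (1/suc (1 ℕ.+ n))
            (trans (cong (ℕtoℚ (2 ℕ.+ n) *_) (recurrence-scaledLhs≡tailSum n)) (tailSum-closed (1 ℕ.+ n)))
            (1/suc-inverseˡ (1 ℕ.+ n)))))
  where
  identity : ∀ N X σ i → N * (N * X) ≡ two * (- (- σ)) → i * N ≡ 1ℚ →
    N * (N * (X - two * (- (- σ)) * (i * i))) ≡ 0ℚ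
  identity N X σ i r₁ r₂ =
    by-relations₂ 1ℚ (- (two * (- (- σ)) * (i * N + 1ℚ))) r₁ r₂ (solve (N ∷ X ∷ σ ∷ i ∷ []) ringℚ)

scaledRhs-recurrence : ∀ n → recurrence scaledRhs n ≡ forcing n
scaledRhs-recurrence n = begin
  recurrence scaledRhs n
    ≡⟨ cong (λ h → two * sign (2 ℕ.+ n) * (S₁ + h) + (two * (two * sign (1 ℕ.+ n) * S₁) + scaledRhs n))
            (H2-increment (1 ℕ.+ n)) ⟩
  two * sign (2 ℕ.+ n) * (S₁ + (H2 (1 ℕ.+ n) + i * i)) + (two * (two * sign (1 ℕ.+ n) * S₁) + scaledRhs n)
    ≡⟨ identity (sign n) (sumTo n H2) (H2 (1 ℕ.+ n)) i ⟩
  forcing n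
    ∎
  where
  S₁ = sumTo (1 ℕ.+ n) H2
  i = 1/suc (1 ℕ.+ n)
  identity : ∀ σ S h i →
    two * (- (- σ)) * (S + h + (h + i * i)) + (two * (two * (- σ) * (S + h)) + two * σ * S) ≡ two * (- (- σ)) * (i * i)
  identity = solve-∀ ringℚ

scaledLhs≡scaledRhs : ∀ m → scaledLhs m ≡ scaledRhs m
scaledLhs≡scaledRhs = recurrence-unique (λ x y → two * x + y) forcing scaledLhs-recurrence scaledRhs-recurrence refl refl

lhs-closed : ∀ m → lhs m ≡ ((+ 2) / suc m) * sign m * sumTo m H2
lhs-closed m = begin
  lhs m                                       ≡⟨ ℚP.*-identityˡ (lhs m) ⟨
  1ℚ * lhs m                                  ≡⟨ cong (_* lhs m) (1/suc-inverseˡ m) ⟨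
  1/suc m * ℕtoℚ (suc m) * lhs m              ≡⟨ ℚP.*-assoc (1/suc m) (ℕtoℚ (suc m)) (lhs m) ⟩
  1/suc m * scaledLhs m                       ≡⟨ cong (1/suc m *_) (scaledLhs≡scaledRhs m) ⟩
  1/suc m * (two * sign m * sumTo m H2)       ≡⟨ regroup (1/suc m) (sign m) (sumTo m H2) ⟩
  two * 1/suc m * sign m * sumTo m H2         ≡⟨ cong (λ t → t * sign m * sumTo m H2) (two/suc m) ⟨
  ((+ 2) / suc m) * sign m * sumTo m H2       ∎
  where
  regroup : ∀ i σ S → i * (two * σ * S) ≡ two * i * σ * S
  regroup = solve-∀ ringℚ

lemma3p1 : (m : ℕ) →
    sumTo m (λ s → ℕtoℚ ((2 ℕ.* s) C s) * ℕtoℚ (s C (m ∸ s)) * sign s * ((+ 1) / suc s) * H2 s)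
      ≡ ((+ 2) / suc m) * sign m * sumTo m H2
lemma3p1 m = begin
  sumTo m (λ s → ℕtoℚ ((2 ℕ.* s) C s) * ℕtoℚ (s C (m ∸ s)) * sign s * ((+ 1) / suc s) * H2 s)
    ≡⟨ sumTo-cong m (λ s s≤m → cong (λ t → central s * ℕtoℚ t * sign s * 1/suc s * H2 s) (B≡C s≤m)) ⟨
  lhs m
    ≡⟨ lhs-closed m ⟩
  ((+ 2) / suc m) * sign m * sumTo m H2
    ∎
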